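{- Let $G=(V,E)$ be a connected interval graph and let $C_1,C_2,\dots,C_k$ be a linear order of the maximal cliques of $G$. Suppose $t\in V$ satisfies: (1) $t$ is simplicial; and (2) letting $C_i$ be the unique maximal clique containing $t$, either $i=1$, or $i=k$, or [$C_{i-1}\cap C_i\subseteq C_i\cap C_{i+1}$ and $|C_i\cap C_{i+1}|\le |C_j\cap C_{j+1}|$ for all $j$ with $i<j<k$], or the analogous bracketed condition holds for the reversed order $C_k,C_{k-1},\dots,C_1$ (i.e. $C_{i+1}\cap C_i\subseteq C_i\cap C_{i-1}$ and $|C_i\cap C_{i-1}|\le|C_j\cap C_{j-1}|$ for all $j$ with $1<j<i$). Then $t$ is the last vertex of some MCS ordering of $G$.
   Context: An interval graph is the intersection graph of a family of intervals on the real line. A linear order of the maximal cliques of $G$ is an enumeration $C_1,\dots,C_k$ of all maximal cliques such that for every vertex $v$, the cliques containing $v$ occur consecutively (such an order exists for every interval graph). A vertex is simplicial if its neighbourhood is a clique (equivalently, in this setting, it lies in exactly one maximal clique). An MCS ordering is any ordering produced by: the first vertex is arbitrary; at each subsequent step, number next an unnumbered vertex with the largest number of already numbered neighbours (any tie-break allowed). -}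

module Defs where

open import Data.Bool using (Bool; true; false; _∧_)
open import Data.Nat using (ℕ; zero; suc; _≤_; _<_; _<ᵇ_; pred)
open import Data.Fin using (Fin; toℕ)
open import Data.Fin.Subset using (Subset; _∈_; _⊆_; _∩_; ∣_∣)
open import Data.List using (List; length; filterᵇ; allFin)
open import Data.Product using (Σ; _×_; ∃; ∃-syntax)
open import Data.Sum using (_⊎_)
open import Data.Rational as ℚ using (ℚ)
open import Function using (_⇔_)
open import Function.Definitions using (Injective)
open import Relation.Nullary using (¬_)
open import Relation.Binary.PropositionalEquality using (_≡_)
open import Relation.Binary.Construct.Closure.ReflexiveTransitive using (Star)

record Graph (n : ℕ) : Set where
  field
    adj    : Fin n → Fin n → Bool
    sym    : ∀ u v → adj u v ≡ adj v u
    irrefl : ∀ v → adj v v ≡ false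

open Graph public

Adj : ∀ {n} → Graph n → Fin n → Fin n → Set
Adj G u v = adj G u v ≡ true

IsIntervalGraph : ∀ {n} → Graph n → Set
IsIntervalGraph {n} G =
  Σ (Fin n → ℚ) λ l → Σ (Fin n → ℚ) λ r →
    (∀ v → l v ℚ.≤ r v) ×
    (∀ u v → ¬ (u ≡ v) → (Adj G u v ⇔ (l u ℚ.≤ r v × l v ℚ.≤ r u)))

Connected : ∀ {n} → Graph n → Set
Connected G = ∀ u v → Star (Adj G) u v

IsClique : ∀ {n} → Graph n → Subset n → Set
IsClique G S = ∀ u v → u ∈ S → v ∈ S → ¬ (u ≡ v) → Adj G u v

IsMaximalClique : ∀ {n} → Graph n → Subset n → Set
IsMaximalClique {n} G S = IsClique G S × (∀ (T : Subset n) → IsClique G T → S ⊆ T → T ⊆ S)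

-- C 1, ..., C k (1-based; values of C outside [1,k] are irrelevant) is a
-- linear order of the maximal cliques of G.
record IsLinearCliqueOrder {n} (G : Graph n) (k : ℕ) (C : ℕ → Subset n) : Set where
  field
    maximal     : ∀ i → 1 ≤ i → i ≤ k → IsMaximalClique G (C i)
    distinct    : ∀ i j → 1 ≤ i → i ≤ k → 1 ≤ j → j ≤ k → C i ≡ C j → i ≡ j
    exhaustive  : ∀ S → IsMaximalClique G S → ∃[ i ] (1 ≤ i × i ≤ k × C i ≡ S)
    consecutive : ∀ v i j l → 1 ≤ i → i ≤ j → j ≤ l → l ≤ k →
                  v ∈ C i → v ∈ C l → v ∈ C j

Simplicial : ∀ {n} → Graph n → Fin n → Set
Simplicial G t = ∀ u v → Adj G t u → Adj G t v → ¬ (u ≡ v) → Adj G u v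

-- An ordering is σ : position ↦ vertex (a bijection Fin n → Fin n).
-- numberedNbrs G σ p w = number of neighbours of w among σ 0, ..., σ (p-1).
numberedNbrs : ∀ {n} → Graph n → (Fin n → Fin n) → ℕ → Fin n → ℕ
numberedNbrs {n} G σ p w = length (filterᵇ (λ q → (toℕ q <ᵇ p) ∧ adj G (σ q) w) (allFin n))

IsMCS : ∀ {n} → Graph n → (Fin n → Fin n) → Set
IsMCS {n} G σ = Injective _≡_ _≡_ σ ×
  (∀ (p q : Fin n) → toℕ p ≤ toℕ q →
     numberedNbrs G σ (toℕ p) (σ q) ≤ numberedNbrs G σ (toℕ p) (σ p))

IsLastVertex : ∀ {n} → (Fin n → Fin n) → Fin n → Set
IsLastVertex {n} σ t = ∃[ p ] (σ p ≡ t × suc (toℕ p) ≡ n)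

Cond2 : ∀ {n} → ℕ → (ℕ → Subset n) → ℕ → Set
Cond2 k C i =
  i ≡ 1 ⊎ i ≡ k ⊎
  ((C (pred i) ∩ C i ⊆ C i ∩ C (suc i)) ×
     (∀ j → i < j → j < k → ∣ C i ∩ C (suc i) ∣ ≤ ∣ C j ∩ C (suc j) ∣)) ⊎
  ((C (suc i) ∩ C i ⊆ C i ∩ C (pred i)) ×
     (∀ j → 1 < j → j < i → ∣ C i ∩ C (pred i) ∣ ≤ ∣ C j ∩ C (pred j) ∣))

-- Visit the maximal cliques in the order C 1, …, C (i - 1), C (i + 1), …, C k, C i and number
-- the vertices by the first visited clique containing them (ties broken by index, t last).
-- If w is numbered before x, every neighbour of x numbered before w lies in the clique at
-- which w first appears, so it is adjacent to w; the inclusion C (i - 1) ∩ C i ⊆ C (i + 1)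
-- keeps this true for cliques visited around the gap left by C i. The one exception is
-- x ∈ C i with w first appearing in C (s + 1), i < s < k: then the neighbours of x numbered
-- before w lie in C i ∩ C (i + 1), which is no larger than C s ∩ C (s + 1), and all of the
-- latter are numbered before w and adjacent to it. The remaining cases of condition (2) are
-- the same argument for the reversed clique order.
module Submission where

open import Defs renaming (sym to adj-sym)

open import Data.Bool using (Bool; true; false; _∧_; T)
open import Data.Bool.Properties using (T-≡; T-∧)
open import Data.Nat
  using (ℕ; zero; suc; _+_; _*_; _∸_; pred; _≤_; _<_; _<ᵇ_; z≤n; s≤s; s≤s⁻¹; _<?_; _≤?_)
open import Data.Nat.Properties
open import Data.Nat.Induction using (<-rec)
import Data.Bool as Bool
import Data.Fin as Fin
open import Data.Fin using (Fin; toℕ; fromℕ; fromℕ<; punchOut) renaming (_≟_ to _≟ᶠ_)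
open import Data.Fin.Properties
  using (toℕ-injective; toℕ<n; toℕ-fromℕ; toℕ-fromℕ<; punchOut-injective; injective⇒≤; any?; all?)
open import Data.Fin.Subset using (Subset; _∈_; _⊆_; _∩_; _∪_; ⁅_⁆; ∣_∣)
open import Data.Fin.Subset.Properties
  using (_∈?_; p∩q⊆q; x∈p∩q⁺; x∈p∩q⁻; x∈⁅x⁆; x∈⁅y⁆⇒x≡y; p⊆p∪q; q⊆p∪q; x∈p∪q⁻; ⊆-trans; ⊆-antisym)
open import Data.Vec using ([]; _∷_; lookup)
open import Data.Vec.Properties using ([]=⇒lookup; lookup⇒[]=)
open import Data.List using (List; []; _∷_; length; filterᵇ; allFin; tabulate; map)
open import Data.List.Properties using (length-map; length-tabulate; length-removeAt′; filter-notAll)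
open import Data.List.Membership.Propositional as List using (lose)
open import Data.List.Membership.Propositional.Properties
  using (∈-allFin; ∈-filter⁺; ∈-filter⁻; ∈-map⁻)
open import Data.List.Relation.Unary.Any using (here; there)
open import Data.List.Relation.Unary.AllPairs using (_∷_)
open import Data.List.Relation.Unary.All as All using ()
open import Data.List.Relation.Unary.Unique.Propositional using (Unique)
import Data.List.Relation.Unary.Unique.Propositional.Properties as Unique
open import Data.List.Relation.Binary.Sublist.Propositional using (⊆-refl)
import Data.List.Relation.Binary.Sublist.Propositional.Properties as Sublist
open import Data.Product using (_×_; _,_; proj₁; proj₂; ∃-syntax; uncurry)
open import Data.Sum using (inj₁; inj₂; [_,_]′)
open import Data.Empty using (⊥-elim)
open import Function using (_∘_; Equivalence)
open import Function.Definitions using (Injective)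
open import Relation.Nullary using (¬_; Dec; yes; no; contradiction)
open import Relation.Nullary.Decidable using (T?; ¬?; _→-dec_; _×-dec_)
open import Relation.Unary using (Decidable)
open import Relation.Binary.Definitions using (tri<; tri≈; tri>)
open import Relation.Binary.PropositionalEquality
  using (_≡_; _≢_; refl; sym; trans; cong; subst; subst₂)

private
  variable
    A : Set
    n : ℕ

count : (Fin n → Bool) → ℕ
count {n} P = length (filterᵇ P (allFin n))

length-filterᵇ-mono : {P Q : A → Bool} → (∀ x → T (P x) → T (Q x)) →
                      ∀ xs → length (filterᵇ P xs) ≤ length (filterᵇ Q xs)
length-filterᵇ-mono {P = P} {Q} P⇒Q xs =
  Sublist.length-mono-≤
    (Sublist.filter⁺ (T? ∘ P) (T? ∘ Q) (λ { refl → P⇒Q _ }) (⊆-refl {x = xs}))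

count-mono : {P Q : Fin n → Bool} → (∀ x → T (P x) → T (Q x)) → count P ≤ count Q
count-mono P⇒Q = length-filterᵇ-mono P⇒Q (allFin _)

length-filterᵇ-mono-< : {P Q : A → Bool} → (∀ x → T (P x) → T (Q x)) →
                        ∀ {y xs} → y List.∈ xs → ¬ T (P y) → T (Q y) →
                        length (filterᵇ P xs) < length (filterᵇ Q xs)
length-filterᵇ-mono-< {P = P} {Q} P⇒Q {xs = x ∷ xs} (here refl) ¬Px Qx with P x | Q x
... | false | true  = s≤s (length-filterᵇ-mono P⇒Q xs)
... | true  | _     = contradiction _ ¬Px
... | false | false = ⊥-elim Qx
length-filterᵇ-mono-< {P = P} {Q} P⇒Q {xs = x ∷ xs} (there y∈xs) ¬Py Qy
  with P x in Px | Q x in Qx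
... | true  | true  = s≤s (length-filterᵇ-mono-< P⇒Q y∈xs ¬Py Qy)
... | true  | false = ⊥-elim (subst T Qx (P⇒Q x (Equivalence.from T-≡ Px)))
... | false | true  = m≤n⇒m≤1+n (length-filterᵇ-mono-< P⇒Q y∈xs ¬Py Qy)
... | false | false = length-filterᵇ-mono-< P⇒Q y∈xs ¬Py Qy

∈-─ : ∀ {x z : A} {ys} (x∈ys : x List.∈ ys) → z List.∈ ys → z ≢ x → z List.∈ ys List.─ x∈ys
∈-─ (here refl)   (here refl)   z≢x = contradiction refl z≢x
∈-─ (here refl)   (there z∈ys)  _   = z∈ys
∈-─ (there x∈ys)  (here refl)   _   = here refl
∈-─ (there x∈ys)  (there z∈ys)  z≢x = there (∈-─ x∈ys z∈ys z≢x)

Unique-length-≤ : {xs ys : List A} → Unique xs → (∀ {z} → z List.∈ xs → z List.∈ ys) →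
                  length xs ≤ length ys
Unique-length-≤ {xs = []}     _            _     = z≤n
Unique-length-≤ {xs = x ∷ xs} {ys} (x∉xs ∷ xs!) xs⊆ys = begin
  suc (length xs)                ≤⟨ s≤s (Unique-length-≤ xs! xs⊆ys─x) ⟩
  suc (length (ys List.─ x∈ys))  ≡⟨ length-removeAt′ ys _ ⟨
  length ys                      ∎
  where
  open ≤-Reasoning
  x∈ys : x List.∈ ys
  x∈ys = xs⊆ys (here refl)
  xs⊆ys─x : ∀ {z} → z List.∈ xs → z List.∈ ys List.─ x∈ys
  xs⊆ys─x z∈xs = ∈-─ x∈ys (xs⊆ys (there z∈xs)) (λ z≡x → All.lookup x∉xs z∈xs (sym z≡x))

count-∘-injective : ∀ {m} {π : Fin m → Fin n} → Injective _≡_ _≡_ π →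
                    (P : Fin n → Bool) → count (P ∘ π) ≤ count P
count-∘-injective {n} {m} {π} π-injective P = begin
  count (P ∘ π)                                ≡⟨ length-map π (filterᵇ (P ∘ π) (allFin m)) ⟨
  length (map π (filterᵇ (P ∘ π) (allFin m)))  ≤⟨ Unique-length-≤ unique image⊆ ⟩
  count P                                      ∎
  where
  open ≤-Reasoning
  unique : Unique (map π (filterᵇ (P ∘ π) (allFin m)))
  unique = Unique.map⁺ π-injective (Unique.filter⁺ (T? ∘ P ∘ π) (Unique.allFin⁺ m))
  image⊆ : ∀ {z} → z List.∈ map π (filterᵇ (P ∘ π) (allFin m)) → z List.∈ filterᵇ P (allFin n)
  image⊆ z∈ with x , x∈ , refl ← ∈-map⁻ π z∈ =
    ∈-filter⁺ (T? ∘ P) (∈-allFin (π x)) (proj₂ (∈-filter⁻ (T? ∘ P ∘ π) {xs = allFin m} x∈))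

count-tabulate : (f : Fin n → A) (P : A → Bool) → length (filterᵇ P (tabulate f)) ≡ count (P ∘ f)
count-tabulate {zero}  f P = refl
count-tabulate {suc n} f P with P (f Fin.zero)
... | true  = cong suc (trans (count-tabulate (f ∘ Fin.suc) P) (sym (count-tabulate Fin.suc (P ∘ f))))
... | false = trans (count-tabulate (f ∘ Fin.suc) P) (sym (count-tabulate Fin.suc (P ∘ f)))

∣p∣≡count-lookup : (p : Subset n) → ∣ p ∣ ≡ count (lookup p)
∣p∣≡count-lookup []          = refl
∣p∣≡count-lookup (true ∷ p)  =
  cong suc (trans (∣p∣≡count-lookup p) (sym (count-tabulate Fin.suc (lookup (true ∷ p)))))
∣p∣≡count-lookup (false ∷ p) =
  trans (∣p∣≡count-lookup p) (sym (count-tabulate Fin.suc (lookup (false ∷ p))))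

∈⇒T-lookup : ∀ {v} {p : Subset n} → v ∈ p → T (lookup p v)
∈⇒T-lookup v∈p = Equivalence.from T-≡ ([]=⇒lookup v∈p)

T-lookup⇒∈ : ∀ {v} (p : Subset n) → T (lookup p v) → v ∈ p
T-lookup⇒∈ p v∈p = lookup⇒[]= _ p (Equivalence.to T-≡ v∈p)

-- Enumerating Fin n in the order of a key

Fin-injective⇒surjective : {f : Fin n → Fin n} → Injective _≡_ _≡_ f → ∀ y → ∃[ x ] (f x ≡ y)
Fin-injective⇒surjective {suc n} {f} f-injective y with any? (λ x → f x ≟ᶠ y)
... | yes hit  = hit
... | no  miss = contradiction (injective⇒≤ {f = g} g-injective) 1+n≰n
  where
  y≢f : ∀ x → y ≢ f x
  y≢f x y≡fx = miss (x , sym y≡fx)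
  g : Fin (suc n) → Fin n
  g x = punchOut (y≢f x)
  g-injective : Injective _≡_ _≡_ g
  g-injective {x} {x′} = f-injective ∘ punchOut-injective (y≢f x) (y≢f x′)

greatest⇒suc-toℕ≡n : (x : Fin n) → (∀ (p : Fin n) → toℕ p ≤ toℕ x) → suc (toℕ x) ≡ n
greatest⇒suc-toℕ≡n {suc n} x greatest =
  ≤-antisym (toℕ<n x) (s≤s (subst (_≤ toℕ x) (toℕ-fromℕ n) (greatest (fromℕ n))))

lex-< : ∀ {a b x y} n → a < b → x < n → a * n + x < b * n + y
lex-< {a} {b} {x} {y} n a<b x<n = begin-strict
  a * n + x  <⟨ +-monoʳ-< (a * n) x<n ⟩
  a * n + n  ≡⟨ +-comm (a * n) n ⟩
  suc a * n  ≤⟨ *-monoˡ-≤ n a<b ⟩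
  b * n      ≤⟨ m≤m+n (b * n) y ⟩
  b * n + y  ∎
  where open ≤-Reasoning

lex-injective : ∀ {a b x y} n → x < n → y < n → a * n + x ≡ b * n + y → a ≡ b × x ≡ y
lex-injective {a} {b} n x<n y<n eq with <-cmp a b
... | tri< a<b _ _ = contradiction eq (<⇒≢ (lex-< n a<b x<n))
... | tri> _ _ b<a = contradiction (sym eq) (<⇒≢ (lex-< n b<a y<n))
... | tri≈ _ refl _ = refl , +-cancelˡ-≡ (a * n) _ _ eq

module RankEnumeration {n} (r : Fin n → ℕ) (r-injective : Injective _≡_ _≡_ r) where

  below : Fin n → Fin n → Bool
  below v u = r u <ᵇ r v

  count-below<n : ∀ v → count (below v) < n
  count-below<n v = subst (count (below v) <_) (length-tabulate (λ x → x))
    (filter-notAll (T? ∘ below v) (allFin n)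
      (lose (∈-allFin v) (<-irrefl refl ∘ <ᵇ⇒< (r v) (r v))))

  -- Opaque, so that unification never unfolds these searches over Fin n.
  opaque
    position : Fin n → Fin n
    position v = fromℕ< (count-below<n v)

    toℕ-position : ∀ v → toℕ (position v) ≡ count (below v)
    toℕ-position v = toℕ-fromℕ< (count-below<n v)

  position-mono-≤ : ∀ {u v} → r u ≤ r v → toℕ (position u) ≤ toℕ (position v)
  position-mono-≤ {u} {v} ru≤rv = subst₂ _≤_ (sym (toℕ-position u)) (sym (toℕ-position v))
    (count-mono λ x x<u → <⇒<ᵇ (<-≤-trans (<ᵇ⇒< (r x) (r u) x<u) ru≤rv))

  position-mono-< : ∀ {u v} → r u < r v → toℕ (position u) < toℕ (position v)
  position-mono-< {u} {v} ru<rv = subst₂ _<_ (sym (toℕ-position u)) (sym (toℕ-position v))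
    (length-filterᵇ-mono-< (λ x x<u → <⇒<ᵇ (<-trans (<ᵇ⇒< (r x) (r u) x<u) ru<rv))
      (∈-allFin u) (<-irrefl refl ∘ <ᵇ⇒< (r u) (r u)) (<⇒<ᵇ ru<rv))

  position-injective : Injective _≡_ _≡_ position
  position-injective {u} {v} eq with <-cmp (r u) (r v)
  ... | tri< ru<rv _ _ = contradiction (cong toℕ eq) (<⇒≢ (position-mono-< ru<rv))
  ... | tri≈ _ ru≡rv _ = r-injective ru≡rv
  ... | tri> _ _ rv<ru = contradiction (cong toℕ eq) (>⇒≢ (position-mono-< rv<ru))

  opaque
    σ : Fin n → Fin n
    σ p = proj₁ (Fin-injective⇒surjective position-injective p)

    position-σ : ∀ p → position (σ p) ≡ p
    position-σ p = proj₂ (Fin-injective⇒surjective position-injective p)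

  σ-position : ∀ v → σ (position v) ≡ v
  σ-position v = position-injective (position-σ (position v))

  σ-injective : Injective _≡_ _≡_ σ
  σ-injective {p} {q} eq = trans (sym (position-σ p)) (trans (cong position eq) (position-σ q))

  σ-increasing : ∀ {p q} → toℕ p < toℕ q → r (σ p) < r (σ q)
  σ-increasing {p} {q} p<q = ≰⇒> λ rq≤rp →
    <⇒≱ p<q (subst₂ (λ a b → toℕ a ≤ toℕ b) (position-σ q) (position-σ p) (position-mono-≤ rq≤rp))

  count-∘-σ : (P : Fin n → Bool) → count (P ∘ σ) ≡ count P
  count-∘-σ P = ≤-antisym (count-∘-injective σ-injective P) (begin
    count P                   ≤⟨ count-mono (λ v → subst (T ∘ P) (sym (σ-position v))) ⟩
    count (P ∘ σ ∘ position)  ≤⟨ count-∘-injective position-injective (P ∘ σ) ⟩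
    count (P ∘ σ)             ∎)
    where open ≤-Reasoning

  maximum-last : ∀ {t} → (∀ v → r v ≤ r t) → suc (toℕ (position t)) ≡ n
  maximum-last {t} maximum = greatest⇒suc-toℕ≡n (position t) λ p →
    subst (λ a → toℕ a ≤ toℕ (position t)) (position-σ p) (position-mono-≤ (maximum (σ p)))

module KeyEnumeration {n} (key : Fin n → ℕ) (t : Fin n) (key≤key-t : ∀ v → key v ≤ key t) where

  tiebreak : Fin n → ℕ
  tiebreak v with v ≟ᶠ t
  ... | yes _ = n
  ... | no  _ = toℕ v

  tiebreak-t : tiebreak t ≡ n
  tiebreak-t with t ≟ᶠ t
  ... | yes _   = refl
  ... | no  t≢t = contradiction refl t≢t

  tiebreak≤n : ∀ v → tiebreak v ≤ n
  tiebreak≤n v with v ≟ᶠ t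
  ... | yes _ = ≤-refl
  ... | no  _ = <⇒≤ (toℕ<n v)

  tiebreak-injective : Injective _≡_ _≡_ tiebreak
  tiebreak-injective {u} {v} eq with u ≟ᶠ t | v ≟ᶠ t
  ... | yes refl | yes refl = refl
  ... | yes _    | no  _    = contradiction eq (>⇒≢ (toℕ<n v))
  ... | no  _    | yes _    = contradiction eq (<⇒≢ (toℕ<n u))
  ... | no  _    | no  _    = toℕ-injective eq

  rank : Fin n → ℕ
  rank v = key v * suc n + tiebreak v

  rank-injective : Injective _≡_ _≡_ rank
  rank-injective {u} {v} eq = tiebreak-injective
    (proj₂ (lex-injective {key u} {key v} (suc n) (s≤s (tiebreak≤n u)) (s≤s (tiebreak≤n v)) eq))

  open RankEnumeration rank rank-injective public
    using (σ; σ-injective; position; position-σ; count-∘-σ)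
  open RankEnumeration rank rank-injective
    using (σ-position; σ-increasing; position-mono-<; maximum-last)

  t-last : IsLastVertex σ t
  t-last = position t , σ-position t , maximum-last rank≤rank-t
    where
    rank≤rank-t : ∀ v → rank v ≤ rank t
    rank≤rank-t v with m≤n⇒m<n∨m≡n (key≤key-t v)
    ... | inj₁ kv<kt = <⇒≤ (lex-< (suc n) kv<kt (s≤s (tiebreak≤n v)))
    ... | inj₂ kv≡kt rewrite kv≡kt | tiebreak-t = +-monoʳ-≤ (key t * suc n) (tiebreak≤n v)

  key-monotone : ∀ {p q} → toℕ p < toℕ q → key (σ p) ≤ key (σ q)
  key-monotone {p} {q} p<q = ≮⇒≥ λ kq<kp →
    <-asym (σ-increasing p<q) (lex-< (suc n) kq<kp (s≤s (tiebreak≤n (σ q))))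

  key-<⇒earlier : ∀ {u v} → key u < key v → toℕ (position u) < toℕ (position v)
  key-<⇒earlier {u} ku<kv = position-mono-< (lex-< (suc n) ku<kv (s≤s (tiebreak≤n u)))

module _ {n} (G : Graph n) where

  Adj-sym : ∀ {u v} → Adj G u v → Adj G v u
  Adj-sym {u} {v} uv = trans (adj-sym G v u) uv

  IsClique? : Decidable (IsClique G)
  IsClique? S = all? λ u → all? λ v →
    u ∈? S →-dec v ∈? S →-dec ¬? (u ≟ᶠ v) →-dec adj G u v Bool.≟ true

  IsClique-⊆ : ∀ {S R} → S ⊆ R → IsClique G R → IsClique G S
  IsClique-⊆ S⊆R R-clique u v u∈S v∈S = R-clique u v (S⊆R u∈S) (S⊆R v∈S)

  grow : Subset n → List (Fin n) → Subset n
  grow S []       = S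
  grow S (v ∷ vs) with IsClique? (⁅ v ⁆ ∪ S)
  ... | yes _ = grow (⁅ v ⁆ ∪ S) vs
  ... | no  _ = grow S vs

  ⊆-grow : ∀ S vs → S ⊆ grow S vs
  ⊆-grow S []       = λ x∈S → x∈S
  ⊆-grow S (v ∷ vs) with IsClique? (⁅ v ⁆ ∪ S)
  ... | yes _ = ⊆-grow (⁅ v ⁆ ∪ S) vs ∘ q⊆p∪q ⁅ v ⁆ S
  ... | no  _ = ⊆-grow S vs

  grow-clique : ∀ {S} vs → IsClique G S → IsClique G (grow S vs)
  grow-clique {S} []       S-clique = S-clique
  grow-clique {S} (v ∷ vs) S-clique with IsClique? (⁅ v ⁆ ∪ S)
  ... | yes vS-clique = grow-clique vs vS-clique
  ... | no  _         = grow-clique vs S-clique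

  grow-maximal : ∀ S vs {R x} → IsClique G R → grow S vs ⊆ R →
                 x List.∈ vs → x ∈ R → x ∈ grow S vs
  grow-maximal S (v ∷ vs) {R} R-clique grow⊆R (here refl) v∈R with IsClique? (⁅ v ⁆ ∪ S)
  ... | yes _         = ⊆-grow (⁅ v ⁆ ∪ S) vs (p⊆p∪q S (x∈⁅x⁆ v))
  ... | no  ¬vS-clique = contradiction (IsClique-⊆ vS⊆R R-clique) ¬vS-clique
    where
    vS⊆R : ⁅ v ⁆ ∪ S ⊆ R
    vS⊆R y∈vS with x∈p∪q⁻ ⁅ v ⁆ S y∈vS
    ... | inj₁ y∈⁅v⁆ = subst (_∈ _) (sym (x∈⁅y⁆⇒x≡y v y∈⁅v⁆)) v∈R
    ... | inj₂ y∈S   = grow⊆R (⊆-grow S vs y∈S)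
  grow-maximal S (v ∷ vs) R-clique grow⊆R (there x∈vs) x∈R with IsClique? (⁅ v ⁆ ∪ S)
  ... | yes _ = grow-maximal (⁅ v ⁆ ∪ S) vs R-clique grow⊆R x∈vs x∈R
  ... | no  _ = grow-maximal S vs R-clique grow⊆R x∈vs x∈R

  extend-to-maximal-clique : ∀ {S} → IsClique G S → ∃[ R ] (IsMaximalClique G R × S ⊆ R)
  extend-to-maximal-clique {S} S-clique =
    grow S (allFin n) ,
    (grow-clique (allFin n) S-clique ,
     λ R R-clique grow⊆R x∈R → grow-maximal S (allFin n) R-clique grow⊆R (∈-allFin _) x∈R) ,
    ⊆-grow S (allFin n)

  simplicial⇒unique-maximal-clique : ∀ {t S S′} → Simplicial G t →
    IsMaximalClique G S → IsMaximalClique G S′ → t ∈ S → t ∈ S′ → S ≡ S′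
  simplicial⇒unique-maximal-clique {t} {S} {S′} t-simplicial
    (S-clique , S-maximal) (S′-clique , S′-maximal) t∈S t∈S′ =
    ⊆-antisym (⊆-trans (p⊆p∪q S′) (S′-maximal _ union-clique (q⊆p∪q S S′)))
              (⊆-trans (q⊆p∪q S S′) (S-maximal _ union-clique (p⊆p∪q S′)))
    where
    across : ∀ u v → u ∈ S → v ∈ S′ → u ≢ v → Adj G u v
    across u v u∈S v∈S′ u≢v with u ≟ᶠ t | v ≟ᶠ t
    ... | yes refl | _        = S′-clique u v t∈S′ v∈S′ u≢v
    ... | no  _    | yes refl = S-clique u v u∈S t∈S u≢v
    ... | no  u≢t  | no  v≢t  = t-simplicial u v
      (S-clique t u t∈S u∈S (u≢t ∘ sym)) (S′-clique t v t∈S′ v∈S′ (v≢t ∘ sym)) u≢v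
    union-clique : IsClique G (S ∪ S′)
    union-clique u v u∈ v∈ u≢v with x∈p∪q⁻ S S′ u∈ | x∈p∪q⁻ S S′ v∈
    ... | inj₁ u∈S  | inj₁ v∈S  = S-clique u v u∈S v∈S u≢v
    ... | inj₂ u∈S′ | inj₂ v∈S′ = S′-clique u v u∈S′ v∈S′ u≢v
    ... | inj₁ u∈S  | inj₂ v∈S′ = across u v u∈S v∈S′ u≢v
    ... | inj₂ u∈S′ | inj₁ v∈S  = Adj-sym (across v u v∈S u∈S′ (u≢v ∘ sym))

  pair-clique : ∀ {u v} → (u ≢ v → Adj G u v) → IsClique G (⁅ u ⁆ ∪ ⁅ v ⁆)
  pair-clique {u} {v} u~v x y x∈ y∈ x≢y
    with x∈p∪q⁻ ⁅ u ⁆ ⁅ v ⁆ x∈ | x∈p∪q⁻ ⁅ u ⁆ ⁅ v ⁆ y∈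
  ... | inj₁ x∈⁅u⁆ | inj₁ y∈⁅u⁆ =
    contradiction (trans (x∈⁅y⁆⇒x≡y u x∈⁅u⁆) (sym (x∈⁅y⁆⇒x≡y u y∈⁅u⁆))) x≢y
  ... | inj₂ x∈⁅v⁆ | inj₂ y∈⁅v⁆ =
    contradiction (trans (x∈⁅y⁆⇒x≡y v x∈⁅v⁆) (sym (x∈⁅y⁆⇒x≡y v y∈⁅v⁆))) x≢y
  ... | inj₁ x∈⁅u⁆ | inj₂ y∈⁅v⁆ with refl ← x∈⁅y⁆⇒x≡y u x∈⁅u⁆ | refl ← x∈⁅y⁆⇒x≡y v y∈⁅v⁆ =
    u~v x≢y
  ... | inj₂ x∈⁅v⁆ | inj₁ y∈⁅u⁆ with refl ← x∈⁅y⁆⇒x≡y v x∈⁅v⁆ | refl ← x∈⁅y⁆⇒x≡y u y∈⁅u⁆ =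
    Adj-sym (u~v (x≢y ∘ sym))

module LinearCliqueOrder {n} {G : Graph n} {k} {C} (order : IsLinearCliqueOrder G k C) where
  open IsLinearCliqueOrder order

  pair-in-clique : ∀ {u v} → (u ≢ v → Adj G u v) → ∃[ m ] (1 ≤ m × m ≤ k × u ∈ C m × v ∈ C m)
  pair-in-clique {u} {v} u~v
    with R , R-maximal , uv⊆R ← extend-to-maximal-clique G (pair-clique G u~v)
    with m , 1≤m , m≤k , refl ← exhaustive R R-maximal =
    m , 1≤m , m≤k , uv⊆R (p⊆p∪q ⁅ v ⁆ (x∈⁅x⁆ u)) , uv⊆R (q⊆p∪q ⁅ u ⁆ ⁅ v ⁆ (x∈⁅x⁆ v))

  vertex-in-clique : ∀ v → ∃[ m ] (1 ≤ m × m ≤ k × v ∈ C m)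
  vertex-in-clique v
    with m , 1≤m , m≤k , v∈Cm , _ ← pair-in-clique {v} {v} (λ v≢v → contradiction refl v≢v) =
    m , 1≤m , m≤k , v∈Cm

  simplicial-in-one-clique : ∀ {t l m} → Simplicial G t → 1 ≤ l → l ≤ k → 1 ≤ m → m ≤ k →
                             t ∈ C l → t ∈ C m → l ≡ m
  simplicial-in-one-clique t-simplicial 1≤l l≤k 1≤m m≤k t∈Cl t∈Cm = distinct _ _ 1≤l l≤k 1≤m m≤k
    (simplicial⇒unique-maximal-clique G t-simplicial
      (maximal _ 1≤l l≤k) (maximal _ 1≤m m≤k) t∈Cl t∈Cm)

-- Reversing a linear clique order

mirror : ℕ → ℕ → ℕ
mirror k j = suc k ∸ j

mirror-involutive : ∀ {k j} → j ≤ suc k → mirror k (mirror k j) ≡ j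
mirror-involutive j≤1+k = m∸[m∸n]≡n j≤1+k

mirror-suc : ∀ k j → mirror k (suc j) ≡ pred (mirror k j)
mirror-suc k j = sym (pred[m∸n]≡m∸[1+n] (suc k) j)

mirror-bounds : ∀ {k j} → 1 ≤ j → j ≤ k → 1 ≤ mirror k j × mirror k j ≤ k
mirror-bounds {k} {suc j} _ j<k = m<n⇒0<n∸m j<k , m∸n≤m k j

mirror-injective : ∀ {k j j′} → j ≤ suc k → j′ ≤ suc k → mirror k j ≡ mirror k j′ → j ≡ j′
mirror-injective {k} j≤1+k j′≤1+k eq =
  trans (sym (mirror-involutive j≤1+k)) (trans (cong (mirror k) eq) (mirror-involutive j′≤1+k))

mirror-antitone-≤ : ∀ {k j j′} → j ≤ j′ → mirror k j′ ≤ mirror k j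
mirror-antitone-≤ {k} = ∸-monoʳ-≤ (suc k)

mirror-antitone : ∀ {k j j′} → j < j′ → j′ ≤ suc k → mirror k j′ < mirror k j
mirror-antitone {k} j<j′ j′≤1+k = ∸-monoʳ-< j<j′ j′≤1+k

RightCondition : ℕ → (ℕ → Subset n) → ℕ → Set
RightCondition k C i =
  (C (pred i) ∩ C i ⊆ C i ∩ C (suc i)) ×
  (∀ j → i < j → j < k → ∣ C i ∩ C (suc i) ∣ ≤ ∣ C j ∩ C (suc j) ∣)

LeftCondition : ℕ → (ℕ → Subset n) → ℕ → Set
LeftCondition k C i =
  (C (suc i) ∩ C i ⊆ C i ∩ C (pred i)) ×
  (∀ j → 1 < j → j < i → ∣ C i ∩ C (pred i) ∣ ≤ ∣ C j ∩ C (pred j) ∣)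

LeftCondition⇒RightCondition-mirror : ∀ {k i} {C : ℕ → Subset n} → 1 ≤ i → i ≤ k →
  LeftCondition k C (mirror k i) → RightCondition k (C ∘ mirror k) i
LeftCondition⇒RightCondition-mirror {k = k} {suc i} {C} _ i<k (separator⊆ , separator≤) =
  subst₂ (λ a c → C a ∩ C (mirror k (suc i)) ⊆ C (mirror k (suc i)) ∩ C c)
    (sym mirror-pred) (sym (mirror-suc k (suc i))) separator⊆ ,
  λ j i<j j<k → subst₂ (λ a b → ∣ C (mirror k (suc i)) ∩ C a ∣ ≤ ∣ C (mirror k j) ∩ C b ∣)
    (sym (mirror-suc k (suc i))) (sym (mirror-suc k j))
    (separator≤ (mirror k j)
      (subst (_< mirror k j) (m+n∸n≡m 1 k) (mirror-antitone j<k (n≤1+n k)))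
      (mirror-antitone i<j (m≤n⇒m≤1+n (<⇒≤ j<k))))
  where
  mirror-pred : mirror k i ≡ suc (mirror k (suc i))
  mirror-pred = +-∸-assoc 1 (<⇒≤ i<k)

mirror-linear-order : ∀ {n} {G : Graph n} {k C} → IsLinearCliqueOrder G k C →
                      IsLinearCliqueOrder G k (C ∘ mirror k)
mirror-linear-order {G = G} {k} {C} order = record
  { maximal     = λ j 1≤j j≤k → uncurry (maximal (mirror k j)) (mirror-bounds 1≤j j≤k)
  ; distinct    = λ a b 1≤a a≤k 1≤b b≤k eq → mirror-injective (m≤n⇒m≤1+n a≤k) (m≤n⇒m≤1+n b≤k)
      (uncurry (uncurry (distinct _ _) (mirror-bounds 1≤a a≤k)) (mirror-bounds 1≤b b≤k) eq)
  ; exhaustive  = exhaustive-mirror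
  ; consecutive = λ v a j l 1≤a a≤j j≤l l≤k v∈Ca v∈Cl → consecutive v _ _ _
      (proj₁ (mirror-bounds (≤-trans 1≤a (≤-trans a≤j j≤l)) l≤k)) (mirror-antitone-≤ j≤l)
      (mirror-antitone-≤ a≤j) (proj₂ (mirror-bounds 1≤a (≤-trans a≤j (≤-trans j≤l l≤k)))) v∈Cl v∈Ca
  }
  where
  open IsLinearCliqueOrder order
  exhaustive-mirror : ∀ S → IsMaximalClique G S → ∃[ j ] (1 ≤ j × j ≤ k × C (mirror k j) ≡ S)
  exhaustive-mirror S S-maximal with m , 1≤m , m≤k , refl ← exhaustive S S-maximal
                                with 1≤m′ , m′≤k ← mirror-bounds {k} 1≤m m≤k =
    mirror k m , 1≤m′ , m′≤k , cong C (mirror-involutive (m≤n⇒m≤1+n m≤k))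

-- An MCS ordering ending at a simplicial vertex

least-witness : {P : ℕ → Set} → Decidable P → ∀ {m} → P m →
                ∃[ s ] (P s × ∀ {s′} → s′ < s → ¬ P s′)
least-witness {P = P} P? {m} = <-rec (λ m → P m → Least) search m
  where
  Least : Set
  Least = ∃[ s ] (P s × ∀ {s′} → s′ < s → ¬ P s′)
  search : ∀ m → (∀ {m′} → m′ < m → P m′ → Least) → P m → Least
  search m rec Pm with anyUpTo? P? m
  ... | no  none              = m , Pm , λ s′<m Ps′ → none (_ , s′<m , Ps′)
  ... | yes (m′ , m′<m , Pm′) = rec m′<m Pm′

module MCSEndingAt {n} {G : Graph n} {k} {C} (order : IsLinearCliqueOrder G k C)
  {t} (t-simplicial : Simplicial G t) {i} (1≤i : 1 ≤ i) (i≤k : i ≤ k) (t∈Ci : t ∈ C i)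
  (right-condition : i < k → RightCondition k C i) where

  open IsLinearCliqueOrder order
  open LinearCliqueOrder order

  visit : ℕ → ℕ
  visit s with s <? i
  ... | yes _ = s
  ... | no  _ with s <? k
  ...   | yes _ = suc s
  ...   | no  _ = i

  visited : ℕ → Subset n
  visited s = C (visit s)

  visit-below : ∀ {s} → s < i → visit s ≡ s
  visit-below {s} s<i with s <? i
  ... | yes _   = refl
  ... | no  s≮i = contradiction s<i s≮i

  visit-above : ∀ {s} → i ≤ s → s < k → visit s ≡ suc s
  visit-above {s} i≤s s<k with s <? i
  ... | yes s<i = contradiction i≤s (<⇒≱ s<i)
  ... | no  _ with s <? k
  ...   | yes _   = refl
  ...   | no  s≮k = contradiction s<k s≮k

  visit-last : visit k ≡ i
  visit-last with k <? i
  ... | yes k<i = contradiction i≤k (<⇒≱ k<i)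
  ... | no  _ with k <? k
  ...   | yes k<k = contradiction k<k (<-irrefl refl)
  ...   | no  _   = refl

  visit-bounds : ∀ {s} → 1 ≤ s → s ≤ k → 1 ≤ visit s × visit s ≤ k
  visit-bounds {s} 1≤s s≤k with s <? i
  ... | yes _ = 1≤s , s≤k
  ... | no  _ with s <? k
  ...   | yes s<k = s≤s z≤n , s<k
  ...   | no  _   = 1≤i , i≤k

  visit-mono : ∀ {a b} → a ≤ b → b < k → visit a ≤ visit b
  visit-mono {a} {b} a≤b b<k with i ≤? a | i ≤? b
  ... | yes i≤a | _
    rewrite visit-above i≤a (≤-<-trans a≤b b<k) | visit-above (≤-trans i≤a a≤b) b<k = s≤s a≤b
  ... | no  a≱i | yes i≤b
    rewrite visit-below (≰⇒> a≱i) | visit-above i≤b b<k = m≤n⇒m≤1+n a≤b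
  ... | no  a≱i | no  b≱i
    rewrite visit-below (≰⇒> a≱i) | visit-below (≰⇒> b≱i) = a≤b

  visited-below : ∀ {s} → s < i → visited s ≡ C s
  visited-below = cong C ∘ visit-below

  visited-above : ∀ {s} → i ≤ s → s < k → visited s ≡ C (suc s)
  visited-above i≤s s<k = cong C (visit-above i≤s s<k)

  visited-last : visited k ≡ C i
  visited-last = cong C visit-last

  visited-clique : ∀ {s} → 1 ≤ s → s ≤ k → IsClique G (visited s)
  visited-clique 1≤s s≤k = proj₁ (uncurry (maximal _) (visit-bounds 1≤s s≤k))

  time : ℕ → ℕ
  time l with <-cmp l i
  ... | tri< _ _ _ = l
  ... | tri≈ _ _ _ = k
  ... | tri> _ _ _ = pred l

  visited-time : ∀ {l} → l ≤ k → visited (time l) ≡ C l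
  visited-time {l} l≤k with <-cmp l i
  ... | tri< l<i _ _   = visited-below l<i
  ... | tri≈ _ refl _  = visited-last
  visited-time {suc l} l<k | tri> _ _ i<l = visited-above (s≤s⁻¹ i<l) l<k

  time-bounds : ∀ {l} → 1 ≤ l → l ≤ k → 1 ≤ time l × time l ≤ k
  time-bounds {l} 1≤l l≤k with <-cmp l i
  ... | tri< _ _ _ = 1≤l , l≤k
  ... | tri≈ _ _ _ = ≤-trans 1≤i i≤k , ≤-refl
  time-bounds {suc l} _ l<k | tri> _ _ i<l = ≤-trans 1≤i (s≤s⁻¹ i<l) , <⇒≤ l<k

  time-below : ∀ {l} → l < i → time l ≡ l
  time-below {l} l<i with <-cmp l i
  ... | tri< _ _ _     = refl
  ... | tri≈ l≮i _ _   = contradiction l<i l≮i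
  ... | tri> l≮i _ _   = contradiction l<i l≮i

  time-<k : ∀ {l} → l ≤ k → l ≢ i → time l < k
  time-<k {l} l≤k l≢i with <-cmp l i
  ... | tri< l<i _ _ = <-≤-trans l<i i≤k
  ... | tri≈ _ l≡i _ = contradiction l≡i l≢i
  time-<k {suc l} l<k _ | tri> _ _ _ = l<k

  ∈-visited-time : ∀ {v l} → l ≤ k → v ∈ C l → v ∈ visited (time l)
  ∈-visited-time l≤k = subst (_ ∈_) (sym (visited-time l≤k))

  Visits : Fin n → ℕ → Set
  Visits v s = 1 ≤ s × v ∈ visited s

  opaque
    first-visit : ∀ v → ∃[ s ] (Visits v s × ∀ {s′} → s′ < s → ¬ Visits v s′)
    first-visit v with l , 1≤l , l≤k , v∈Cl ← vertex-in-clique v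
                  with s , v-at-s , minimal ← least-witness (λ s → 1 ≤? s ×-dec v ∈? visited s)
                         (proj₁ (time-bounds 1≤l l≤k) , ∈-visited-time l≤k v∈Cl) =
      s , v-at-s , minimal

  key : Fin n → ℕ
  key v = proj₁ (first-visit v)

  1≤key : ∀ v → 1 ≤ key v
  1≤key v = proj₁ (proj₁ (proj₂ (first-visit v)))

  ∈-visited-key : ∀ v → v ∈ visited (key v)
  ∈-visited-key v = proj₂ (proj₁ (proj₂ (first-visit v)))

  key-minimal : ∀ {v s} → 1 ≤ s → v ∈ visited s → key v ≤ s
  key-minimal {v} 1≤s v∈ = ≮⇒≥ λ s<key → proj₂ (proj₂ (first-visit v)) s<key (1≤s , v∈)

  key≤time : ∀ {v l} → 1 ≤ l → l ≤ k → v ∈ C l → key v ≤ time l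
  key≤time 1≤l l≤k v∈Cl = key-minimal (proj₁ (time-bounds 1≤l l≤k)) (∈-visited-time l≤k v∈Cl)

  key≤k : ∀ v → key v ≤ k
  key≤k v with l , 1≤l , l≤k , v∈Cl ← vertex-in-clique v =
    ≤-trans (key≤time 1≤l l≤k v∈Cl) (proj₂ (time-bounds 1≤l l≤k))

  visit≡i⇒≡k : ∀ {s} → s ≤ k → visit s ≡ i → s ≡ k
  visit≡i⇒≡k {s} s≤k eq with i ≤? s
  ... | no  s≱i = contradiction (trans (sym (visit-below (≰⇒> s≱i))) eq) (<⇒≢ (≰⇒> s≱i))
  ... | yes i≤s with m≤n⇒m<n∨m≡n s≤k
  ...   | inj₁ s<k = contradiction (trans (sym (visit-above i≤s s<k)) eq) (>⇒≢ (s≤s i≤s))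
  ...   | inj₂ s≡k = s≡k

  key-t : key t ≡ k
  key-t = visit≡i⇒≡k (key≤k t) (simplicial-in-one-clique t-simplicial
    (proj₁ (visit-bounds (1≤key t) (key≤k t))) (proj₂ (visit-bounds (1≤key t) (key≤k t))) 1≤i i≤k
    (∈-visited-key t) t∈Ci)

  ∈-C[1+i] : ∀ {u a} → i < k → 1 ≤ a → a < k → u ∈ visited a → u ∈ C i → u ∈ C (suc i)
  ∈-C[1+i] {u} {a} i<k 1≤a a<k u∈ u∈Ci with i ≤? a
  ... | yes i≤a = consecutive u i (suc i) (suc a) 1≤i (n≤1+n i) (s≤s i≤a) a<k u∈Ci
                    (subst (u ∈_) (visited-above i≤a a<k) u∈)
  ... | no  a≱i = p∩q⊆q (C i) (C (suc i)) (proj₁ (right-condition i<k) (x∈p∩q⁺ (u∈C[i-1] , u∈Ci)))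
    where
    a<i : a < i
    a<i = ≰⇒> a≱i
    u∈C[i-1] : u ∈ C (pred i)
    u∈C[i-1] = consecutive u a (pred i) i 1≤a (<⇒≤pred a<i) pred[n]≤n i≤k
                 (subst (u ∈_) (visited-below a<i) u∈) u∈Ci

  visited-convex : ∀ {u a s b} → 1 ≤ a → a ≤ s → s ≤ b → b < k →
                   u ∈ visited a → u ∈ visited b → u ∈ visited s
  visited-convex {u} {a} {s} {b} 1≤a a≤s s≤b b<k =
    consecutive u (visit a) (visit s) (visit b) (proj₁ (visit-bounds 1≤a a≤k))
      (visit-mono a≤s (≤-<-trans s≤b b<k)) (visit-mono s≤b b<k) (proj₂ (visit-bounds 1≤b (<⇒≤ b<k)))
    where
    1≤b : 1 ≤ b
    1≤b = ≤-trans 1≤a (≤-trans a≤s s≤b)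
    a≤k : a ≤ k
    a≤k = ≤-trans a≤s (≤-trans s≤b (<⇒≤ b<k))

  visited-convex-last : ∀ {u a s} → 1 ≤ a → a ≤ s → s ≤ i → u ∈ visited a → u ∈ C i → u ∈ visited s
  visited-convex-last {u} {a} {s} 1≤a a≤s s≤i u∈a u∈Ci with m≤n⇒m<n∨m≡n s≤i
  ... | inj₁ s<i = subst (u ∈_) (sym (visited-below s<i)) (consecutive u a s i 1≤a a≤s s≤i i≤k
                     (subst (u ∈_) (visited-below (≤-<-trans a≤s s<i)) u∈a) u∈Ci)
  ... | inj₂ refl with m≤n⇒m<n∨m≡n i≤k
  ...   | inj₁ i<k  = subst (u ∈_) (sym (visited-above ≤-refl i<k))
                        (∈-C[1+i] i<k 1≤a (≤-<-trans a≤s i<k) u∈a u∈Ci)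
  ...   | inj₂ refl = subst (u ∈_) (sym visited-last) u∈Ci

  earlier-neighbour-visited : ∀ {u x s} → key u ≤ s → s ≤ key x → Adj G u x →
                              ¬ (i < s × s < k × x ∈ C i) → u ∈ visited s
  earlier-neighbour-visited {u} {x} {s} ku≤s s≤kx u~x not-special
    with l , 1≤l , l≤k , u∈Cl , x∈Cl ← pair-in-clique (λ _ → u~x) | l ≟ i
  ... | no l≢i   = visited-convex (1≤key u) ku≤s (≤-trans s≤kx (key≤time 1≤l l≤k x∈Cl))
                     (time-<k l≤k l≢i) (∈-visited-key u) (∈-visited-time l≤k u∈Cl)
  ... | yes refl with s ≤? i | s <? k
  ...   | yes s≤i | _       = visited-convex-last (1≤key u) ku≤s s≤i (∈-visited-key u) u∈Cl
  ...   | no  s≰i | yes s<k = contradiction (≰⇒> s≰i , s<k , x∈Cl) not-special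
  ...   | no  _   | no  s≮k = subst (λ s → u ∈ visited s)
                                (≤-antisym (≮⇒≥ s≮k) (≤-trans s≤kx (key≤k x)))
                                (subst (u ∈_) (sym visited-last) u∈Cl)

  only-clique : ∀ {x l} → i < key x → x ∈ C i → 1 ≤ l → l ≤ k → x ∈ C l → l ≡ i
  only-clique {x} {l} i<kx x∈Ci 1≤l l≤k x∈Cl with <-cmp l i
  ... | tri< l<i _ _ = contradiction (subst (key x ≤_) (time-below l<i) (key≤time 1≤l l≤k x∈Cl))
                                     (<⇒≱ (<-trans l<i i<kx))
  ... | tri≈ _ l≡i _ = l≡i
  ... | tri> _ _ i<l = contradiction (key-minimal 1≤i x∈visited-i) (<⇒≱ i<kx)
    where
    x∈visited-i : x ∈ visited i
    x∈visited-i = subst (x ∈_) (sym (visited-above ≤-refl (<-≤-trans i<l l≤k)))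
                    (consecutive x i (suc i) l 1≤i (n≤1+n i) i<l l≤k x∈Ci x∈Cl)

  earlier-neighbour-separator : ∀ {u x s} → i < s → s < k → key u ≤ s → s ≤ key x → Adj G u x →
                                x ∈ C i → u ∈ C i ∩ C (suc i)
  earlier-neighbour-separator {u} i<s s<k ku≤s s≤kx u~x x∈Ci
    with l , 1≤l , l≤k , u∈Cl , x∈Cl ← pair-in-clique (λ _ → u~x)
    with refl ← only-clique (<-≤-trans i<s s≤kx) x∈Ci 1≤l l≤k x∈Cl =
    x∈p∩q⁺ (u∈Cl , ∈-C[1+i] (<-trans i<s s<k) (1≤key u) (≤-<-trans ku≤s s<k) (∈-visited-key u) u∈Cl)

  separator-visited : ∀ {u s} → i < s → s < k → u ∈ C s ∩ C (suc s) → key u < s × u ∈ visited s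
  separator-visited {u} {suc s} i<1+s 1+s<k u∈
    with u∈Cs , u∈C[1+s] ← x∈p∩q⁻ (C (suc s)) (C (suc (suc s))) u∈ =
    s≤s (key-minimal (≤-trans 1≤i i≤s) (subst (u ∈_) (sym (visited-above i≤s s<k)) u∈Cs)) ,
    subst (u ∈_) (sym (visited-above (<⇒≤ i<1+s) 1+s<k)) u∈C[1+s]
    where
    i≤s : i ≤ s
    i≤s = s≤s⁻¹ i<1+s
    s<k : s < k
    s<k = <-trans (n<1+n s) 1+s<k

  key≤key-t : ∀ v → key v ≤ key t
  key≤key-t v = subst (key v ≤_) (sym key-t) (key≤k v)

  open KeyEnumeration key t key≤key-t

  -- numberedNbrs G σ (toℕ p) x is count (earlier-neighbour p x) by definition.
  earlier-neighbour : Fin n → Fin n → Fin n → Bool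
  earlier-neighbour p x q = (toℕ q <ᵇ toℕ p) ∧ adj G (σ q) x

  earlier-neighbour⁻ : ∀ {p x q} → T (earlier-neighbour p x q) → toℕ q < toℕ p × Adj G (σ q) x
  earlier-neighbour⁻ {p} {x} {q} h =
    let q<p , q~x = Equivalence.to (T-∧ {toℕ q <ᵇ toℕ p} {adj G (σ q) x}) h
    in <ᵇ⇒< (toℕ q) (toℕ p) q<p , Equivalence.to (T-≡ {adj G (σ q) x}) q~x

  earlier-neighbour⁺ : ∀ {p x q} → toℕ q < toℕ p → Adj G (σ q) x → T (earlier-neighbour p x q)
  earlier-neighbour⁺ {p} {x} {q} q<p q~x = Equivalence.from (T-∧ {toℕ q <ᵇ toℕ p} {adj G (σ q) x})
    (<⇒<ᵇ q<p , Equivalence.from (T-≡ {adj G (σ q) x}) q~x)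

  adjacent-to-key-clique : ∀ {u w} → u ∈ visited (key w) → u ≢ w → Adj G u w
  adjacent-to-key-clique {u} {w} u∈ u≢w =
    visited-clique (1≤key w) (key≤k w) u w u∈ (∈-visited-key w) u≢w

  general-step : ∀ {p q} → toℕ p < toℕ q → ¬ (i < key (σ p) × key (σ p) < k × σ q ∈ C i) →
                 ∀ q′ → T (earlier-neighbour p (σ q) q′) → T (earlier-neighbour p (σ p) q′)
  general-step {p} p<q not-special q′ h =
    let q′<p , u~x = earlier-neighbour⁻ h
    in earlier-neighbour⁺ q′<p (adjacent-to-key-clique
         (earlier-neighbour-visited (key-monotone q′<p) (key-monotone p<q) u~x not-special)
         (<⇒≢ q′<p ∘ cong toℕ ∘ σ-injective))

  separator-step : ∀ {p q} → toℕ p < toℕ q → i < key (σ p) → key (σ p) < k → σ q ∈ C i →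
                   count (earlier-neighbour p (σ q)) ≤ count (earlier-neighbour p (σ p))
  separator-step {p} {q} p<q i<s s<k x∈Ci = begin
    count (earlier-neighbour p (σ q))   ≤⟨ count-mono neighbour⇒separator ⟩
    count (lookup Sᵢ ∘ σ)               ≡⟨ count-∘-σ (lookup Sᵢ) ⟩
    count (lookup Sᵢ)                   ≡⟨ ∣p∣≡count-lookup Sᵢ ⟨
    ∣ Sᵢ ∣                              ≤⟨ proj₂ (right-condition (<-trans i<s s<k)) s i<s s<k ⟩
    ∣ Sₛ ∣                              ≡⟨ ∣p∣≡count-lookup Sₛ ⟩
    count (lookup Sₛ)                   ≡⟨ count-∘-σ (lookup Sₛ) ⟨
    count (lookup Sₛ ∘ σ)               ≤⟨ count-mono separator⇒neighbour ⟩
    count (earlier-neighbour p (σ p))   ∎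
    where
    open ≤-Reasoning
    s : ℕ
    s = key (σ p)
    Sᵢ Sₛ : Subset n
    Sᵢ = C i ∩ C (suc i)
    Sₛ = C s ∩ C (suc s)
    neighbour⇒separator : ∀ q′ → T (earlier-neighbour p (σ q) q′) → T (lookup Sᵢ (σ q′))
    neighbour⇒separator q′ h =
      let q′<p , u~x = earlier-neighbour⁻ h
      in ∈⇒T-lookup
           (earlier-neighbour-separator i<s s<k (key-monotone q′<p) (key-monotone p<q) u~x x∈Ci)
    separator⇒neighbour : ∀ q′ → T (lookup Sₛ (σ q′)) → T (earlier-neighbour p (σ p) q′)
    separator⇒neighbour q′ h =
      let ku<s , u∈ = separator-visited i<s s<k (T-lookup⇒∈ Sₛ h)
      in earlier-neighbour⁺
           (subst₂ (λ a b → toℕ a < toℕ b) (position-σ q′) (position-σ p) (key-<⇒earlier ku<s))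
           (adjacent-to-key-clique u∈ (<⇒≢ ku<s ∘ cong key))

  earlier-step : ∀ {p q} → toℕ p < toℕ q →
                 count (earlier-neighbour p (σ q)) ≤ count (earlier-neighbour p (σ p))
  earlier-step {p} {q} p<q = by-cases (i <? key (σ p) ×-dec key (σ p) <? k ×-dec σ q ∈? C i)
    where
    by-cases : Dec (i < key (σ p) × key (σ p) < k × σ q ∈ C i) →
               count (earlier-neighbour p (σ q)) ≤ count (earlier-neighbour p (σ p))
    by-cases (yes (i<s , s<k , x∈Ci)) = separator-step p<q i<s s<k x∈Ci
    by-cases (no  not-special)        = count-mono (general-step p<q not-special)

  σ-is-MCS : IsMCS G σ
  σ-is-MCS = σ-injective , λ p q p≤q → [ earlier-step , same-step p q ]′ (m≤n⇒m<n∨m≡n p≤q)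
    where
    same-step : ∀ p q → toℕ p ≡ toℕ q →
                count (earlier-neighbour p (σ q)) ≤ count (earlier-neighbour p (σ p))
    same-step p q p≡q =
      ≤-reflexive (cong (count ∘ earlier-neighbour p ∘ σ) (sym (toℕ-injective p≡q)))

  mcs-ending-at-t : ∃[ σ ] (IsMCS G σ × IsLastVertex σ t)
  mcs-ending-at-t = σ , σ-is-MCS , t-last

mcs-ending-at-simplicial : ∀ {n} {G : Graph n} {k C} → IsLinearCliqueOrder G k C →
  ∀ {t} → Simplicial G t → ∀ {i} → 1 ≤ i → i ≤ k → t ∈ C i → (i < k → RightCondition k C i) →
  ∃[ σ ] (IsMCS G σ × IsLastVertex σ t)
mcs-ending-at-simplicial = MCSEndingAt.mcs-ending-at-t

lemma24 : ∀ {n} (G : Graph n) → IsIntervalGraph G → Connected G →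
    (k : ℕ) (C : ℕ → Subset n) → IsLinearCliqueOrder G k C →
    (t : Fin n) → Simplicial G t →
    (i : ℕ) → 1 ≤ i → i ≤ k → t ∈ C i → Cond2 k C i →
    ∃[ σ ] (IsMCS G σ × IsLastVertex σ t)
lemma24 G _ _ k C order t t-simplicial i 1≤i i≤k t∈Ci (inj₁ refl) =
  mcs-ending-at-simplicial (mirror-linear-order order) t-simplicial i≤k ≤-refl
    (subst (t ∈_) (cong C (sym (m+n∸n≡m 1 k))) t∈Ci) (⊥-elim ∘ <-irrefl refl)
lemma24 G _ _ k C order t t-simplicial i 1≤i i≤k t∈Ci (inj₂ (inj₁ refl)) =
  mcs-ending-at-simplicial order t-simplicial 1≤i i≤k t∈Ci (⊥-elim ∘ <-irrefl refl)
lemma24 G _ _ k C order t t-simplicial i 1≤i i≤k t∈Ci (inj₂ (inj₂ (inj₁ right))) =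
  mcs-ending-at-simplicial order t-simplicial 1≤i i≤k t∈Ci (λ _ → right)
lemma24 G _ _ k C order t t-simplicial i 1≤i i≤k t∈Ci (inj₂ (inj₂ (inj₂ left))) =
  mcs-ending-at-simplicial (mirror-linear-order order) t-simplicial 1≤i′ i′≤k
    (subst (t ∈_) (cong C (sym i″≡i)) t∈Ci)
    (λ _ → LeftCondition⇒RightCondition-mirror {C = C} 1≤i′ i′≤k (subst (LeftCondition k C) (sym i″≡i) left))
  where
  i″≡i : mirror k (mirror k i) ≡ i
  i″≡i = mirror-involutive (m≤n⇒m≤1+n i≤k)
  1≤i′ : 1 ≤ mirror k i
  1≤i′ = proj₁ (mirror-bounds 1≤i i≤k)
  i′≤k : mirror k i ≤ k
  i′≤k = proj₂ (mirror-bounds 1≤i i≤k)
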